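{- Let $G$ and $H$ be graphs each with at least two vertices. Then the corona product $G\circ H$ has a barbell partition.
   Context: All graphs are finite and simple. For $V(G)=\{g_1,\dots,g_k\}$ and $V(H)=\{h_1,\dots,h_m\}$, the corona product $G\circ H$ has vertex set $\{g_i\}\cup\{h_{i,j}: 1\le i\le k,1\le j\le m\}$, with $g_ig_{i'}$ an edge iff it is an edge of $G$, $g_i$ adjacent to $h_{i,j}$ for all $j$, and $h_{i,j_1}$ adjacent to $h_{i,j_2}$ iff $h_{j_1}h_{j_2}\in E(H)$; no other edges. A barbell partition of a graph $K$ is a partition of $V(K)$ into three disjoint sets $\{R,W_1,W_2\}$ with $W_1,W_2\neq\emptyset$ ($R$ may be empty), no edges between $W_1$ and $W_2$, and $|N_K(r)\cap W_i|\neq 1$ for all $r\in R$, $i\in\{1,2\}$. -}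

module Defs where

open import Data.Nat using (ℕ)
open import Data.Fin using (Fin)
open import Data.Fin.Properties as FinP using ()
open import Data.Product using (_×_; _,_)
open import Data.Sum using (_⊎_; inj₁; inj₂)
open import Data.Empty using (⊥)
open import Data.Unit using (⊤)
open import Data.List using (List; length; filter; allFin; map; concatMap)
open import Relation.Nullary using (Dec; ¬_; yes; no)
open import Relation.Nullary.Decidable using (_×-dec_)
open import Relation.Binary.PropositionalEquality using (_≡_; _≢_)

record Graph (n : ℕ) : Set₁ where
  field
    Adj      : Fin n → Fin n → Set
    adj?     : ∀ u v → Dec (Adj u v)
    sym      : ∀ {u v} → Adj u v → Adj v u
    irrefl   : ∀ {u} → ¬ Adj u u
open Graph public

-- Vertices of the corona G ∘ H (|V(G)| = k, |V(H)| = m):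
--   inj₁ i       is g_i
--   inj₂ (i , j) is h_{i,j}
CVert : ℕ → ℕ → Set
CVert k m = Fin k ⊎ (Fin k × Fin m)

cverts : (k m : ℕ) → List (CVert k m)
cverts k m = map inj₁ (allFin k)
  Data.List.++ concatMap (λ i → map (λ j → inj₂ (i , j)) (allFin m)) (allFin k)

CAdj : ∀ {k m} → Graph k → Graph m → CVert k m → CVert k m → Set
CAdj G H (inj₁ i) (inj₁ i') = Adj G i i'
CAdj G H (inj₁ i) (inj₂ (i' , j)) = i ≡ i'
CAdj G H (inj₂ (i , j)) (inj₁ i') = i ≡ i'
CAdj G H (inj₂ (i , j₁)) (inj₂ (i' , j₂)) = (i ≡ i') × Adj H j₁ j₂

CAdj? : ∀ {k m} (G : Graph k) (H : Graph m) → ∀ u v → Dec (CAdj G H u v)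
CAdj? G H (inj₁ i) (inj₁ i') = adj? G i i'
CAdj? G H (inj₁ i) (inj₂ (i' , j)) = i FinP.≟ i'
CAdj? G H (inj₂ (i , j)) (inj₁ i') = i FinP.≟ i'
CAdj? G H (inj₂ (i , j₁)) (inj₂ (i' , j₂)) = (i FinP.≟ i') ×-dec adj? H j₁ j₂

-- A partition of the vertex set into three labelled blocks R, W₁, W₂.
data Block : Set where
  R W₁ W₂ : Block

_≟B_ : (a b : Block) → Dec (a ≡ b)
R ≟B R = yes _≡_.refl
R ≟B W₁ = no λ ()
R ≟B W₂ = no λ ()
W₁ ≟B R = no λ ()
W₁ ≟B W₁ = yes _≡_.refl
W₁ ≟B W₂ = no λ ()
W₂ ≟B R = no λ ()
W₂ ≟B W₁ = no λ ()
W₂ ≟B W₂ = yes _≡_.refl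

nbrCount : ∀ {k m} (G : Graph k) (H : Graph m) → (CVert k m → Block)
         → CVert k m → Block → ℕ
nbrCount {k} {m} G H p v b =
  length (filter (λ u → CAdj? G H v u ×-dec (p u ≟B b)) (cverts k m))

record IsBarbell {k m} (G : Graph k) (H : Graph m) (p : CVert k m → Block) : Set where
  field
    W₁-nonempty : Data.Product.∃ λ v → p v ≡ W₁
    W₂-nonempty : Data.Product.∃ λ v → p v ≡ W₂
    no-W₁W₂     : ∀ u v → p u ≡ W₁ → p v ≡ W₂ → ¬ CAdj G H u v
    R-cond₁     : ∀ r → p r ≡ R → nbrCount G H p r W₁ ≢ 1
    R-cond₂     : ∀ r → p r ≡ R → nbrCount G H p r W₂ ≢ 1

{-# OPTIONS --safe #-}
module Submission where

-- Colour the whole copy of H hanging at one vertex g_a as W₁, the copy at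
-- another vertex g_b as W₂, and everything else as R. Distinct copies of H
-- are never adjacent, so W₁ and W₂ are separated. A vertex g_i of G sees
-- either its entire copy of H (at least two vertices) or nothing of a
-- given W-block, and a vertex of an R-coloured copy of H has no W-neighbour
-- at all; so no R-vertex has exactly one neighbour in W₁ or in W₂.

open import Defs hiding (sym)
open import Data.Nat using (ℕ; _+_; _≤_; _≥_; s≤s; z≤n)
open import Data.Nat.Properties using (≤-trans; >⇒≢; module ≤-Reasoning)
open import Data.Product using (∃; _,_; _×_)
open import Data.Sum using (inj₁; inj₂)
open import Data.Fin using (Fin; zero; suc; fromℕ<)
open import Data.List using (List; _∷_; length; filter; map; concatMap; allFin)
open import Data.List.Properties using (length-map; length-tabulate; filter-all; filter-none)
open import Data.List.Membership.Propositional using (_∈_)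
open import Data.List.Membership.Propositional.Properties using (∈-allFin)
open import Data.List.Relation.Unary.Any using (here; there)
open import Data.List.Relation.Unary.All using (All; universal)
open import Data.List.Relation.Unary.All.Properties using (map⁺)
open import Data.List.Relation.Binary.Sublist.Propositional using (_⊆_; ⊆-refl)
open import Data.List.Relation.Binary.Sublist.Propositional.Properties
  using (++⁺ˡ; ++⁺ʳ; filter⁺; length-mono-≤)
open import Level using (0ℓ)
open import Relation.Nullary using (¬_; yes; no)
open import Relation.Nullary.Decidable using (_×-dec_)
open import Relation.Unary using (Pred; Decidable)
open import Relation.Binary.PropositionalEquality
  using (_≡_; _≢_; refl; sym; trans; cong; subst)

module _ {A : Set} {P : Pred A 0ℓ} (P? : Decidable P) where

  length-filter-none : (∀ x → ¬ P x) → ∀ xs → length (filter P? xs) ≡ 0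
  length-filter-none ¬P xs = cong length (filter-none P? (universal ¬P xs))

  length≤length-filter : ∀ {xs ys} → xs ⊆ ys → All P xs → length xs ≤ length (filter P? ys)
  length≤length-filter xs⊆ys Pxs =
    subst (_≤ _) (cong length (filter-all P? Pxs))
          (length-mono-≤ (filter⁺ P? P? (λ { refl Px → Px }) xs⊆ys))

⊆-concatMap : ∀ {A B : Set} (f : A → List B) {x xs} → x ∈ xs → f x ⊆ concatMap f xs
⊆-concatMap f              (here refl)  = ++⁺ʳ _ ⊆-refl
⊆-concatMap f {xs = y ∷ _} (there x∈xs) = ++⁺ˡ (f y) (⊆-concatMap f x∈xs)

fibreLabelling : ∀ {k m} → (Fin k → Block) → CVert k m → Block
fibreLabelling c (inj₁ _)       = R
fibreLabelling c (inj₂ (i , _)) = c i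

W₁≢W₂ : W₁ ≢ W₂
W₁≢W₂ ()

module _ {k m : ℕ} (G : Graph k) (H : Graph m) where

  fibre : Fin k → List (CVert k m)
  fibre i = map (λ j → inj₂ (i , j)) (allFin m)

  fibre⊆cverts : ∀ i → fibre i ⊆ cverts k m
  fibre⊆cverts i = ++⁺ˡ (map inj₁ (allFin k)) (⊆-concatMap fibre (∈-allFin i))

  length-fibre : ∀ i → length (fibre i) ≡ m
  length-fibre i = trans (length-map _ (allFin m)) (length-tabulate (λ j → j))

  NbrIn : (CVert k m → Block) → CVert k m → Block → Pred (CVert k m) 0ℓ
  NbrIn p v b u = CAdj G H v u × p u ≡ b

  nbrIn? : ∀ p v b → Decidable (NbrIn p v b)
  nbrIn? p v b u = CAdj? G H v u ×-dec (p u ≟B b)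

  nbrCount-none : ∀ p v b → (∀ u → CAdj G H v u → p u ≢ b) → nbrCount G H p v b ≡ 0
  nbrCount-none p v b noNbr =
    length-filter-none (nbrIn? p v b) (λ { u (adj , pu≡b) → noNbr u adj pu≡b }) (cverts k m)

  fibre≤nbrCount : ∀ p i b → (∀ j → p (inj₂ (i , j)) ≡ b) → m ≤ nbrCount G H p (inj₁ i) b
  fibre≤nbrCount p i b fibre≡b = begin
    m                         ≡⟨ length-fibre i ⟨
    length (fibre i)          ≤⟨ length≤length-filter (nbrIn? p (inj₁ i) b) (fibre⊆cverts i) fibreNbrs ⟩
    nbrCount G H p (inj₁ i) b ∎
    where
    open ≤-Reasoning
    fibreNbrs : All (NbrIn p (inj₁ i) b) (fibre i)
    fibreNbrs = map⁺ (universal (λ j → refl , fibre≡b j) (allFin m))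

  module _ (m≥2 : m ≥ 2) (c : Fin k → Block) where

    private
      label = fibreLabelling {m = m} c

    nbrCount≢1 : ∀ b → b ≢ R → ∀ r → label r ≡ R → nbrCount G H label r b ≢ 1
    nbrCount≢1 b b≢R (inj₁ i) _ with c i ≟B b
    ... | yes ci≡b = >⇒≢ (≤-trans m≥2 (fibre≤nbrCount label i b (λ _ → ci≡b)))
    ... | no  ci≢b = subst (_≢ 1) (sym (nbrCount-none label (inj₁ i) b noNbr)) λ ()
      where
      noNbr : ∀ u → CAdj G H (inj₁ i) u → label u ≢ b
      noNbr (inj₁ _)        _    R≡b = b≢R (sym R≡b)
      noNbr (inj₂ (.i , _)) refl     = ci≢b
    nbrCount≢1 b b≢R (inj₂ (i , j)) ci≡R =
      subst (_≢ 1) (sym (nbrCount-none label (inj₂ (i , j)) b noNbr)) λ ()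
      where
      noNbr : ∀ u → CAdj G H (inj₂ (i , j)) u → label u ≢ b
      noNbr (inj₁ _)        _          R≡b  = b≢R (sym R≡b)
      noNbr (inj₂ (.i , _)) (refl , _) ci≡b = b≢R (trans (sym ci≡b) ci≡R)

    fibreLabelling-isBarbell : ∃ (λ a → c a ≡ W₁) → ∃ (λ b → c b ≡ W₂) → IsBarbell G H label
    fibreLabelling-isBarbell (a , ca≡W₁) (b , cb≡W₂) = record
      { W₁-nonempty = inj₂ (a , j₀) , ca≡W₁
      ; W₂-nonempty = inj₂ (b , j₀) , cb≡W₂
      ; no-W₁W₂     = separated
      ; R-cond₁     = nbrCount≢1 W₁ λ ()
      ; R-cond₂     = nbrCount≢1 W₂ λ ()
      }
      where
      j₀ : Fin m
      j₀ = fromℕ< (≤-trans (s≤s z≤n) m≥2)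
      separated : ∀ u v → label u ≡ W₁ → label v ≡ W₂ → ¬ CAdj G H u v
      separated (inj₁ _)       _               ()
      separated (inj₂ _)       (inj₁ _)        _     ()
      separated (inj₂ (i , _)) (inj₂ (.i , _)) ci≡W₁ ci≡W₂ (refl , _) =
        W₁≢W₂ (trans (sym ci≡W₁) ci≡W₂)

twoFibres : ∀ {k} → Fin (2 + k) → Block
twoFibres zero          = W₁
twoFibres (suc zero)    = W₂
twoFibres (suc (suc _)) = R

mainTheorem14 : (k m : ℕ) → k ≥ 2 → m ≥ 2 → (G : Graph k) → (H : Graph m) →
                  ∃ λ (p : CVert k m → Block) → IsBarbell G H p
mainTheorem14 _ _ (s≤s (s≤s _)) m≥2 G H =
  fibreLabelling twoFibres , fibreLabelling-isBarbell G H m≥2 twoFibres (zero , refl) (suc zero , refl)
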